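{- Let $P_1,P_2$ be $r$-colored posets such that the sets $\{|a|: a\in P_1,\ |a|\ne0\}$ and $\{|b|: b\in P_2,\ |b|\ne0\}$ are disjoint. Then for every integer $j\ge0$, \[ \Omega_{P_1\sqcup P_2}(j)=\Omega_{P_1}(j)\cdot\Omega_{P_2}(j). \]
   Context: Fix integers $r\ge 1$, $n\ge 1$. For a totally ordered set $Y$, let $Y_{(r)}=\{0,\dots,r-1\}\times Y$ with the lexicographic order; write $x_k$ for $(k,x)$, $Y_k=\{k\}\times Y$, $|x_k|=x$, $\epsilon(x_k)=k$. Color subscripts are read modulo $r$; $[0,n]=\{0,\dots,n\}$. An $r$-colored poset is a finite set $P=\{0_1,\dots,0_{r-1}\}\cup Q$, $Q\subseteq[n]_{(r)}$ with pairwise distinct absolute values, with a partial order $\prec$ such that $0_1\prec\cdots\prec0_{r-1}$. $P_1\sqcup P_2$ denotes the colored poset on $P_1\cup P_2$ (elements $0_1,\dots,0_{r-1}$ shared) with order generated by those of $P_1,P_2$. With $X=[0,j]$ (least element $0$, greatest element $j$), a colored $P$-partition is a map $f:P\to X_{(r)}$ with (i) $f(0_k)=(k,0)$; (ii) $a\prec b\Rightarrow f(a)\le f(b)$; (iii) if $a\prec b$, $f(a),f(b)\in X_k$ for the same $k$, and $|a|_{\epsilon(a)-k}>|b|_{\epsilon(b)-k}$ in $[0,n]_{(r)}$, then $f(a)<f(b)$; (iv) if $f(a)=(k,j)$ then $\epsilon(a)=k$. $\Omega_P(j)$ is the number of colored $P$-partitions with values in $[0,j]_{(r)}$. -}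

module Defs where

open import Data.Nat using (ℕ; zero; suc; _<_; _≤_; _∸_; _+_; _%_; NonZero)
open import Data.Fin using (Fin; toℕ)
open import Data.List using (List; []; _∷_; _++_; map; drop; length; lookup; allFin)
open import Data.List.Membership.Propositional using (_∈_)
open import Data.List.Relation.Unary.All using (All)
open import Data.List.Relation.Unary.AllPairs using (AllPairs)
open import Data.List.Relation.Unary.Unique.Propositional using (Unique)
open import Data.Vec using (Vec) renaming (lookup to vlookup)
open import Data.Product using (Σ; _×_; _,_; proj₁; proj₂)
open import Data.Sum using (_⊎_)
open import Relation.Binary.PropositionalEquality using (_≡_; _≢_)
open import Relation.Binary.Construct.Closure.Transitive using (TransClosure)
open import Relation.Nullary using (¬_)
open import Function.Bundles using (_⇔_)

-- Colored elements  x_k = (k , x)  ∈  ℕ_(r) ;  ε(x_k) = k , |x_k| = x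

Elt : ℕ → Set
Elt r = Fin r × ℕ

ε : ∀ {r} → Elt r → Fin r
ε = proj₁

∣_∣ : ∀ {r} → Elt r → ℕ
∣_∣ = proj₂

zeroElts : (r : ℕ) → List (Elt r)
zeroElts r = drop 1 (map (λ k → (k , 0)) (allFin r))

record ColStruct (r : ℕ) : Set₁ where
  field
    Q   : List (Elt r)
    _≺_ : Elt r → Elt r → Set

open ColStruct public

elems : ∀ {r} → ColStruct r → List (Elt r)
elems {r} S = zeroElts r ++ Q S

record IsColoredPoset (r n : ℕ) (S : ColStruct r) : Set where
  field
    Q-range    : All (λ a → 1 ≤ ∣ a ∣ × ∣ a ∣ ≤ n) (Q S)
    Q-distinct : AllPairs (λ a b → ∣ a ∣ ≢ ∣ b ∣) (Q S)
    ≺-dom      : ∀ {a b} → _≺_ S a b → (a ∈ elems S) × (b ∈ elems S)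
    ≺-irrefl   : ∀ {a} → ¬ (_≺_ S a a)
    ≺-trans    : ∀ {a b c} → _≺_ S a b → _≺_ S b c → _≺_ S a c
    zeros-chain : ∀ (k l : Fin r) → 0 < toℕ k → toℕ k < toℕ l →
                  _≺_ S (k , 0) (l , 0)

record ColoredPoset (r n : ℕ) : Set₁ where
  field
    struct : ColStruct r
    isColoredPoset : IsColoredPoset r n struct

open ColoredPoset public

_⊔_ : ∀ {r} → ColStruct r → ColStruct r → ColStruct r
S₁ ⊔ S₂ = record
  { Q   = Q S₁ ++ Q S₂
  ; _≺_ = TransClosure (λ a b → _≺_ S₁ a b ⊎ _≺_ S₂ a b)
  }

AbsDisjoint : ∀ {r n} → ColoredPoset r n → ColoredPoset r n → Set
AbsDisjoint P₁ P₂ = ∀ a b → a ∈ elems (struct P₁) → b ∈ elems (struct P₂) →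
                    ∣ a ∣ ≢ 0 → ∣ a ∣ ≢ ∣ b ∣

X : ℕ → ℕ → Set
X r j = Fin r × Fin (suc j)

_<X_ : ∀ {r j} → X r j → X r j → Set
(k , x) <X (k' , x') = toℕ k < toℕ k' ⊎ (k ≡ k' × toℕ x < toℕ x')

_≤X_ : ∀ {r j} → X r j → X r j → Set
u ≤X v = u <X v ⊎ u ≡ v

_<L_ : ℕ × ℕ → ℕ × ℕ → Set
(c , x) <L (c' , x') = c < c' ⊎ (c ≡ c' × x < x')

-- |a|_{ε(a) - k}  (color read modulo r)
shift : ∀ {r} ⦃ _ : NonZero r ⦄ → Fin r → Elt r → ℕ × ℕ
shift {r} k a = ((toℕ (ε a) + (r ∸ toℕ k)) % r , ∣ a ∣)

-- Colored P-partitions.  A map f : P → X_(r) is a vector indexed by the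
-- positions of the duplicate-free list  elems S.

record IsColoredPartition {r} ⦃ _ : NonZero r ⦄ (S : ColStruct r) (j : ℕ)
         (f : Vec (X r j) (length (elems S))) : Set where
  private
    E : Fin (length (elems S)) → Elt r
    E i = lookup (elems S) i
    F : Fin (length (elems S)) → X r j
    F i = vlookup f i
  field
    cond-i   : ∀ i → ∣ E i ∣ ≡ 0 → F i ≡ (ε (E i) , Fin.zero)
    cond-ii  : ∀ i i' → _≺_ S (E i) (E i') → F i ≤X F i'
    cond-iii : ∀ i i' → _≺_ S (E i) (E i') → proj₁ (F i) ≡ proj₁ (F i') →
               shift (proj₁ (F i)) (E i') <L shift (proj₁ (F i)) (E i) →
               F i <X F i'
    cond-iv  : ∀ i → toℕ (proj₂ (F i)) ≡ j → proj₁ (F i) ≡ ε (E i)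

record HasSize {A : Set} (S : A → Set) (N : ℕ) : Set where
  field
    list     : List A
    unique   : Unique list
    complete : ∀ x → (x ∈ list) ⇔ S x
    size     : length list ≡ N

Ω : ∀ {r} ⦃ _ : NonZero r ⦄ → ColStruct r → ℕ → ℕ → Set
Ω S j N = HasSize (IsColoredPartition S j) N

module Submission where

-- A colored (P₁ ⊔ P₂)-partition restricts to a P₁- and a P₂-partition.
-- Conversely, a P₁- and a P₂-partition agree on the shared elements, which
-- by disjointness of absolute values are the zeros 0_k, fixed by (i); so they
-- glue to one map h.  The relations of P₁ ⊔ P₂ not in P₁ or P₂ pass through
-- a shared zero, and every partition increases strictly into a zero: if
-- a ≺ 0_k and f(a) = f(0_k) = (k,0), then (iii) applies since, measured from
-- color k, 0_k is the least element of [0,n]_(r).  Hence h is strictly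
-- increasing along such relations and satisfies (ii) and (iii) there.
-- Gluing and restricting are mutually inverse, giving the product formula.

open import Data.Fin as Fin using (toℕ; _≟_)
open import Data.Fin.Properties using (toℕ<n)
open import Data.List using (List; []; _∷_; _++_; map; length; lookup; allFin; cartesianProduct)
import Data.List.Membership.DecPropositional as DecMembership
open import Data.List.Membership.Propositional using (_∈_)
open import Data.List.Membership.Propositional.Properties
  using (∈-lookup; ∈-map⁻; ∈-map⁺; ∈-++⁻; ∈-++⁺ˡ; ∈-++⁺ʳ; ∈-cartesianProduct⁺; ∈-cartesianProduct⁻)
open import Data.List.Properties using (length-++; length-map; map-∘; map-id-local)
open import Data.List.Relation.Unary.All as All using (All)
import Data.List.Relation.Unary.All.Properties as AllP
open import Data.List.Relation.Unary.AllPairs as AllPairs using (AllPairs; []; _∷_)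
import Data.List.Relation.Unary.AllPairs.Properties as AllPairsP
open import Data.List.Relation.Unary.Any using (here; there)
open import Data.List.Relation.Unary.Unique.Propositional using (Unique)
import Data.List.Relation.Unary.Unique.Propositional.Properties as Unique
open import Data.Nat as ℕ using (ℕ; zero; suc; _*_; _+_; _%_; _≤_; z<s; NonZero)
open import Data.Nat.DivMod using (n%n≡0)
open import Data.Nat.Properties using (m+[n∸m]≡n; <⇒≤; n≢0⇒n>0; >⇒≢; <-trans)
open import Data.Product using (_×_; _,_; proj₁; proj₂)
open import Data.Product.Properties using (≡-dec)
open import Data.Sum using (_⊎_; inj₁; inj₂; [_,_]′)
open import Data.Vec using (Vec; []; _∷_; tabulate) renaming (lookup to vlookup)
open import Data.Vec.Properties using (lookup∘tabulate; tabulate-cong)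
open import Defs
open import Function using (_∘_)
open import Function.Bundles using (mk⇔; Equivalence)
open import Relation.Binary.Construct.Closure.Transitive using ([_]; _∷_)
open import Relation.Binary.Definitions using (DecidableEquality)
open import Relation.Binary.PropositionalEquality
open import Relation.Nullary using (yes; no; contradiction)
open import Relation.Nullary.Decidable using (decidable-stable)

length-cartesianProduct : ∀ {A B : Set} (xs : List A) (ys : List B) →
                          length (cartesianProduct xs ys) ≡ length xs * length ys
length-cartesianProduct []       ys = refl
length-cartesianProduct (x ∷ xs) ys = begin
  length (map (x ,_) ys ++ cartesianProduct xs ys)
    ≡⟨ length-++ (map (x ,_) ys) ⟩
  length (map (x ,_) ys) + length (cartesianProduct xs ys)
    ≡⟨ cong₂ _+_ (length-map (x ,_) ys) (length-cartesianProduct xs ys) ⟩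
  length ys + length xs * length ys
    ∎
  where open ≡-Reasoning

HasSize-× : ∀ {A B : Set} {S₁ : A → Set} {S₂ : B → Set} {N₁ N₂} →
            HasSize S₁ N₁ → HasSize S₂ N₂ →
            HasSize (λ p → S₁ (proj₁ p) × S₂ (proj₂ p)) (N₁ * N₂)
HasSize-× H₁ H₂ = record
  { list     = cartesianProduct l₁ l₂
  ; unique   = Unique.cartesianProduct⁺ (HasSize.unique H₁) (HasSize.unique H₂)
  ; complete = λ (x , y) → mk⇔
      (λ m → let m₁ , m₂ = ∈-cartesianProduct⁻ l₁ l₂ m
             in Equivalence.to (complete₁ x) m₁ , Equivalence.to (complete₂ y) m₂)
      (λ (s₁ , s₂) → ∈-cartesianProduct⁺ (Equivalence.from (complete₁ x) s₁)
                                          (Equivalence.from (complete₂ y) s₂))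
  ; size     = trans (length-cartesianProduct l₁ l₂)
                     (cong₂ _*_ (HasSize.size H₁) (HasSize.size H₂))
  }
  where
    open HasSize H₁ using () renaming (list to l₁; complete to complete₁)
    open HasSize H₂ using () renaming (list to l₂; complete to complete₂)

HasSize-transport : ∀ {A B : Set} {S : A → Set} {T : B → Set} {N}
                    (f : A → B) (g : B → A) →
                    (∀ {x} → S x → T (f x)) → (∀ {y} → T y → S (g y)) →
                    (∀ {x} → S x → g (f x) ≡ x) → (∀ {y} → T y → f (g y) ≡ y) →
                    HasSize S N → HasSize T N
HasSize-transport {S = S} {T} f g f-resp g-resp g∘f f∘g H = record
  { list     = map f list
  ; unique   = Unique.map⁻ (subst Unique (sym g∘f-on-list) unique)
  ; complete = λ y → mk⇔ to (from y)
  ; size     = trans (length-map f list) size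
  }
  where
    open HasSize H
    listed : ∀ {x} → x ∈ list → S x
    listed {x} = Equivalence.to (complete x)
    g∘f-on-list : map g (map f list) ≡ list
    g∘f-on-list = trans (sym (map-∘ list)) (map-id-local (All.tabulate (g∘f ∘ listed)))
    to : ∀ {y} → y ∈ map f list → T y
    to m with ∈-map⁻ f m
    ... | x , x∈list , refl = f-resp (listed x∈list)
    from : ∀ y → T y → y ∈ map f list
    from y t = subst (_∈ map f list) (f∘g t)
                     (∈-map⁺ f (Equivalence.from (complete (g y)) (g-resp t)))

-- Functions on the members of a list, as vectors along the list

module _ {A B : Set} where

  toVec : (xs : List A) → (A → B) → Vec B (length xs)
  toVec xs f = tabulate (f ∘ lookup xs)

  lookup-toVec : ∀ xs (f : A → B) i → vlookup (toVec xs f) i ≡ f (lookup xs i)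
  lookup-toVec xs f = lookup∘tabulate (f ∘ lookup xs)

  toVec-cong : ∀ xs {f g : A → B} → (∀ {a} → a ∈ xs → f a ≡ g a) → toVec xs f ≡ toVec xs g
  toVec-cong xs f≗g = tabulate-cong (λ i → f≗g (∈-lookup i))

  data Entry (xs : List A) (v : Vec B (length xs)) : A → B → Set where
    entry : ∀ i → Entry xs v (lookup xs i) (vlookup v i)

  entry-there : ∀ {x y xs v a b} → Entry xs v a b → Entry (x ∷ xs) (y ∷ v) a b
  entry-there (entry i) = entry (Fin.suc i)

  toVec-entry : ∀ {xs f a b} → Entry xs (toVec xs f) a b → b ≡ f a
  toVec-entry {xs} {f} (entry i) = lookup-toVec xs f i

  module _ (_≟ᴬ_ : DecidableEquality A) (fallback : A → B) where

    fromVec : (xs : List A) → Vec B (length xs) → A → B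
    fromVec []       []       a = fallback a
    fromVec (x ∷ xs) (y ∷ v) a with a ≟ᴬ x
    ... | yes _ = y
    ... | no  _ = fromVec xs v a

    fromVec-entry : ∀ {xs v a} → a ∈ xs → Entry xs v a (fromVec xs v a)
    fromVec-entry {x ∷ xs} {y ∷ v} {a} a∈ with a ≟ᴬ x | a∈
    ... | yes refl | _         = entry Fin.zero
    ... | no  a≢x  | here a≡x  = contradiction a≡x a≢x
    ... | no  _    | there a∈′ = entry-there (fromVec-entry a∈′)

    fromVec-toVec : ∀ {xs} (f : A → B) {a} → a ∈ xs → fromVec xs (toVec xs f) a ≡ f a
    fromVec-toVec f a∈ = toVec-entry (fromVec-entry a∈)

    toVec-fromVec : ∀ {xs} (v : Vec B (length xs)) → Unique xs → toVec xs (fromVec xs v) ≡ v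
    toVec-fromVec {[]}     []      []           = refl
    toVec-fromVec {x ∷ xs} (y ∷ v) (x∉xs ∷ xs!) =
      cong₂ _∷_ at-head (trans (toVec-cong xs at-tail) (toVec-fromVec v xs!))
      where
        at-head : fromVec (x ∷ xs) (y ∷ v) x ≡ y
        at-head with x ≟ᴬ x
        ... | yes _   = refl
        ... | no  x≢x = contradiction refl x≢x
        at-tail : ∀ {a} → a ∈ xs → fromVec (x ∷ xs) (y ∷ v) a ≡ fromVec xs v a
        at-tail {a} a∈ with a ≟ᴬ x
        ... | yes refl = contradiction refl (All.lookup x∉xs a∈)
        ... | no  _    = refl

module _ {r j : ℕ} {u v w : X r j} where

  <X-trans : u <X v → v <X w → u <X w
  <X-trans (inj₁ k<k′)         (inj₁ k′<k″)         = inj₁ (<-trans k<k′ k′<k″)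
  <X-trans (inj₁ k<k′)         (inj₂ (refl , _))    = inj₁ k<k′
  <X-trans (inj₂ (refl , _))   (inj₁ k<k″)          = inj₁ k<k″
  <X-trans (inj₂ (refl , x<y)) (inj₂ (refl , y<z))  = inj₂ (refl , <-trans x<y y<z)

  <X-≤X-trans : u <X v → v ≤X w → u <X w
  <X-≤X-trans u<v (inj₁ v<w)  = <X-trans u<v v<w
  <X-≤X-trans u<v (inj₂ refl) = u<v

  ≤X-<X-trans : u ≤X v → v <X w → u <X w
  ≤X-<X-trans (inj₁ u<v)  v<w = <X-trans u<v v<w
  ≤X-<X-trans (inj₂ refl) v<w = v<w

origin-<L : ∀ c x → x ≢ 0 → (0 , 0) <L (c , x)
origin-<L zero    x x≢0 = inj₂ (refl , n≢0⇒n>0 x≢0)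
origin-<L (suc c) x _   = inj₁ z<s

shift-zero-<L : ∀ {r} ⦃ _ : NonZero r ⦄ (c a : Elt r) → ∣ c ∣ ≡ 0 → ∣ a ∣ ≢ 0 →
                shift (ε c) c <L shift (ε c) a
shift-zero-<L {r} c a c≡0 a≢0 =
  subst (_<L shift (ε c) a) (sym shift-c≡origin) (origin-<L _ ∣ a ∣ a≢0)
  where
    shift-c≡origin : shift (ε c) c ≡ (0 , 0)
    shift-c≡origin = cong₂ _,_
      (trans (cong (_% r) (m+[n∸m]≡n (<⇒≤ (toℕ<n (ε c))))) (n%n≡0 r)) c≡0

module _ {r : ℕ} where

  _≟ᴱ_ : DecidableEquality (Elt r)
  _≟ᴱ_ = ≡-dec _≟_ ℕ._≟_

  zeroElts-∣∣≡0 : All (λ z → ∣ z ∣ ≡ 0) (zeroElts r)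
  zeroElts-∣∣≡0 = AllP.drop⁺ 1 (AllP.map⁺ (All.universal (λ _ → refl) (allFin r)))

  zeroElts-unique : Unique (zeroElts r)
  zeroElts-unique = Unique.drop⁺ 1 (Unique.map⁺ (cong proj₁) (Unique.allFin⁺ r))

  elems-unique : (S : ColStruct r) → AllPairs (λ a b → ∣ a ∣ ≢ ∣ b ∣) (Q S) →
                 All (λ a → 1 ≤ ∣ a ∣) (Q S) → Unique (elems S)
  elems-unique S distinct positive = AllPairsP.++⁺ zeroElts-unique
    (AllPairs.map (λ ∣a∣≢∣b∣ → ∣a∣≢∣b∣ ∘ cong ∣_∣) distinct)
    (All.map (λ ∣z∣≡0 → All.map (λ ∣q∣>0 z≡q → >⇒≢ ∣q∣>0 (trans (cong ∣_∣ (sym z≡q)) ∣z∣≡0))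
                                 positive)
             zeroElts-∣∣≡0)

  module _ (S₁ S₂ : ColStruct r) where

    ∈-⊔⁻ : ∀ {a} → a ∈ elems (S₁ ⊔ S₂) → a ∈ elems S₁ ⊎ a ∈ elems S₂
    ∈-⊔⁻ a∈ with ∈-++⁻ (zeroElts r) a∈
    ... | inj₁ a∈Z = inj₁ (∈-++⁺ˡ a∈Z)
    ... | inj₂ a∈Q with ∈-++⁻ (Q S₁) a∈Q
    ...   | inj₁ a∈Q₁ = inj₁ (∈-++⁺ʳ (zeroElts r) a∈Q₁)
    ...   | inj₂ a∈Q₂ = inj₂ (∈-++⁺ʳ (zeroElts r) a∈Q₂)

    ∈-⊔⁺ˡ : ∀ {a} → a ∈ elems S₁ → a ∈ elems (S₁ ⊔ S₂)
    ∈-⊔⁺ˡ a∈ with ∈-++⁻ (zeroElts r) a∈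
    ... | inj₁ a∈Z  = ∈-++⁺ˡ a∈Z
    ... | inj₂ a∈Q₁ = ∈-++⁺ʳ (zeroElts r) (∈-++⁺ˡ a∈Q₁)

    ∈-⊔⁺ʳ : ∀ {a} → a ∈ elems S₂ → a ∈ elems (S₁ ⊔ S₂)
    ∈-⊔⁺ʳ a∈ with ∈-++⁻ (zeroElts r) a∈
    ... | inj₁ a∈Z  = ∈-++⁺ˡ a∈Z
    ... | inj₂ a∈Q₂ = ∈-++⁺ʳ (zeroElts r) (∈-++⁺ʳ (Q S₁) a∈Q₂)

-- Colored partitions as functions

module _ {r : ℕ} ⦃ _ : NonZero r ⦄ {j : ℕ} where

  FixesZero : Elt r → X r j → Set
  FixesZero a u = ∣ a ∣ ≡ 0 → u ≡ (ε a , Fin.zero)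

  DescentStrict : Elt r → Elt r → X r j → X r j → Set
  DescentStrict a b u v = proj₁ u ≡ proj₁ v → shift (proj₁ u) b <L shift (proj₁ u) a → u <X v

  TopColored : Elt r → X r j → Set
  TopColored a u = toℕ (proj₂ u) ≡ j → proj₁ u ≡ ε a

  record IsPartitionMap (S : ColStruct r) (f : Elt r → X r j) : Set where
    field
      fixes-zero     : ∀ {a} → a ∈ elems S → FixesZero a (f a)
      monotone       : ∀ {a b} → a ∈ elems S → b ∈ elems S → _≺_ S a b → f a ≤X f b
      descent-strict : ∀ {a b} → a ∈ elems S → b ∈ elems S → _≺_ S a b →
                       DescentStrict a b (f a) (f b)
      top-colored    : ∀ {a} → a ∈ elems S → TopColored a (f a)

  open IsPartitionMap

  IsPartitionMap-cong : ∀ {S f g} → (∀ {a} → a ∈ elems S → f a ≡ g a) →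
                        IsPartitionMap S f → IsPartitionMap S g
  IsPartitionMap-cong f≗g F = record
    { fixes-zero     = λ {a} a∈ → subst (FixesZero a) (f≗g a∈) (fixes-zero F a∈)
    ; monotone       = λ a∈ b∈ a≺b → subst₂ _≤X_ (f≗g a∈) (f≗g b∈) (monotone F a∈ b∈ a≺b)
    ; descent-strict = λ {a} {b} a∈ b∈ a≺b → subst₂ (DescentStrict a b) (f≗g a∈) (f≗g b∈)
                                                    (descent-strict F a∈ b∈ a≺b)
    ; top-colored    = λ {a} a∈ → subst (TopColored a) (f≗g a∈) (top-colored F a∈)
    }

  IsPartitionMap-restrict : ∀ {S T f} → (∀ {a} → a ∈ elems S → a ∈ elems T) →
                            (∀ {a b} → _≺_ S a b → _≺_ T a b) →
                            IsPartitionMap T f → IsPartitionMap S f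
  IsPartitionMap-restrict ⊆T ≺⇒≺T F = record
    { fixes-zero     = fixes-zero F ∘ ⊆T
    ; monotone       = λ a∈ b∈ → monotone F (⊆T a∈) (⊆T b∈) ∘ ≺⇒≺T
    ; descent-strict = λ a∈ b∈ → descent-strict F (⊆T a∈) (⊆T b∈) ∘ ≺⇒≺T
    ; top-colored    = top-colored F ∘ ⊆T
    }

  asVec : (S : ColStruct r) → (Elt r → X r j) → Vec (X r j) (length (elems S))
  asVec S = toVec (elems S)

  asMap : (S : ColStruct r) → Vec (X r j) (length (elems S)) → Elt r → X r j
  asMap S = fromVec _≟ᴱ_ (λ a → (ε a , Fin.zero)) (elems S)

  asVec-asMap : ∀ S {v} → Unique (elems S) → asVec S (asMap S v) ≡ v
  asVec-asMap S {v} = toVec-fromVec _≟ᴱ_ _ v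

  asMap-asVec : ∀ S f {a} → a ∈ elems S → asMap S (asVec S f) a ≡ f a
  asMap-asVec S f = fromVec-toVec _≟ᴱ_ _ f

  asVec-isColoredPartition : ∀ {S f} → IsPartitionMap S f → IsColoredPartition S j (asVec S f)
  asVec-isColoredPartition {S} {f} F = record
    { cond-i   = λ i → subst (FixesZero (E i)) (sym (at i)) (fixes-zero F (∈-lookup i))
    ; cond-ii  = λ i i′ a≺b → subst₂ _≤X_ (sym (at i)) (sym (at i′))
                                      (monotone F (∈-lookup i) (∈-lookup i′) a≺b)
    ; cond-iii = λ i i′ a≺b → subst₂ (DescentStrict (E i) (E i′)) (sym (at i)) (sym (at i′))
                                      (descent-strict F (∈-lookup i) (∈-lookup i′) a≺b)
    ; cond-iv  = λ i → subst (TopColored (E i)) (sym (at i)) (top-colored F (∈-lookup i))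
    }
    where
      E = lookup (elems S)
      at = lookup-toVec (elems S) f

  asMap-isPartitionMap : ∀ {S v} → IsColoredPartition S j v → IsPartitionMap S (asMap S v)
  asMap-isPartitionMap {S} {v} C = record
    { fixes-zero     = λ a∈ → fixes (entryOf a∈)
    ; monotone       = λ a∈ b∈ → mono (entryOf a∈) (entryOf b∈)
    ; descent-strict = λ a∈ b∈ → strict (entryOf a∈) (entryOf b∈)
    ; top-colored    = λ a∈ → top (entryOf a∈)
    }
    where
      open IsColoredPartition C
      es = elems S
      entryOf : ∀ {a} → a ∈ es → Entry es v a (asMap S v a)
      entryOf = fromVec-entry _≟ᴱ_ _
      fixes : ∀ {a u} → Entry es v a u → FixesZero a u
      fixes (entry i) = cond-i i
      mono : ∀ {a b u w} → Entry es v a u → Entry es v b w → _≺_ S a b → u ≤X w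
      mono (entry i) (entry i′) = cond-ii i i′
      strict : ∀ {a b u w} → Entry es v a u → Entry es v b w →
               _≺_ S a b → DescentStrict a b u w
      strict (entry i) (entry i′) = cond-iii i i′
      top : ∀ {a u} → Entry es v a u → TopColored a u
      top (entry i) = cond-iv i

  module _ {n S f} (C : IsColoredPoset r n S) (F : IsPartitionMap S f) where
    open IsColoredPoset C

    ≺⇒≤X : ∀ {a b} → _≺_ S a b → f a ≤X f b
    ≺⇒≤X a≺b = monotone F (proj₁ (≺-dom a≺b)) (proj₂ (≺-dom a≺b)) a≺b

    ≺⇒descentStrict : ∀ {a b} → _≺_ S a b → DescentStrict a b (f a) (f b)
    ≺⇒descentStrict a≺b = descent-strict F (proj₁ (≺-dom a≺b)) (proj₂ (≺-dom a≺b)) a≺b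

    ≺-zero⇒<X : ∀ {a c} → _≺_ S a c → ∣ c ∣ ≡ 0 → f a <X f c
    ≺-zero⇒<X {a} {c} a≺c ∣c∣≡0 = strictly (≺⇒≤X a≺c)
      where
        fc≡ : f c ≡ (ε c , Fin.zero)
        fc≡ = fixes-zero F (proj₂ (≺-dom a≺c)) ∣c∣≡0
        strictly : f a ≤X f c → f a <X f c
        strictly (inj₁ fa<fc) = fa<fc
        strictly (inj₂ fa≡fc) with ∣ a ∣ ℕ.≟ 0
        ... | yes ∣a∣≡0 = contradiction (subst (_≺_ S a) (sym a≡c) a≺c) ≺-irrefl
          where
            fa≡ : f a ≡ (ε a , Fin.zero)
            fa≡ = fixes-zero F (proj₁ (≺-dom a≺c)) ∣a∣≡0
            a≡c : a ≡ c
            a≡c = cong₂ _,_ (cong proj₁ (trans (sym fa≡) (trans fa≡fc fc≡)))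
                            (trans ∣a∣≡0 (sym ∣c∣≡0))
        ... | no ∣a∣≢0 = ≺⇒descentStrict a≺c (cong proj₁ fa≡fc)
          (subst (λ k → shift k c <L shift k a) (sym (cong proj₁ (trans fa≡fc fc≡)))
                 (shift-zero-<L c a ∣c∣≡0 ∣a∣≢0))

-- Gluing partitions of P₁ and P₂

module Gluing {r n : ℕ} ⦃ _ : NonZero r ⦄ (P₁ P₂ : ColoredPoset r n)
              (disjoint : AbsDisjoint P₁ P₂) (j : ℕ) where

  private
    S₁ = struct P₁
    S₂ = struct P₂
    U  = S₁ ⊔ S₂
    C₁ = isColoredPoset P₁
    C₂ = isColoredPoset P₂
    module C₁ = IsColoredPoset C₁
    module C₂ = IsColoredPoset C₂
    Map = Elt r → X r j

  open IsPartitionMap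
  open DecMembership (_≟ᴱ_ {r}) using (_∈?_)

  shared-zero : ∀ {a} → a ∈ elems S₁ → a ∈ elems S₂ → ∣ a ∣ ≡ 0
  shared-zero {a} a∈₁ a∈₂ =
    decidable-stable (∣ a ∣ ℕ.≟ 0) (λ ∣a∣≢0 → disjoint a a a∈₁ a∈₂ ∣a∣≢0 refl)

  partitions-agree : ∀ {f₁ f₂ : Map} → IsPartitionMap S₁ f₁ → IsPartitionMap S₂ f₂ →
                     ∀ {a} → a ∈ elems S₁ → a ∈ elems S₂ → f₁ a ≡ f₂ a
  partitions-agree F₁ F₂ a∈₁ a∈₂ =
    trans (fixes-zero F₁ a∈₁ zero₀) (sym (fixes-zero F₂ a∈₂ zero₀))
    where zero₀ = shared-zero a∈₁ a∈₂

  module _ {h : Map} (H₁ : IsPartitionMap S₁ h) (H₂ : IsPartitionMap S₂ h) where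

    data ⊔-View (a b : Elt r) : Set where
      via₁   : _≺_ S₁ a b → ⊔-View a b
      via₂   : _≺_ S₂ a b → ⊔-View a b
      ascent : h a <X h b → ⊔-View a b

    -- In the mixed cases the middle element lies in both posets, so it is a zero.
    ⊔-view : ∀ {a b} → _≺_ U a b → ⊔-View a b
    ⊔-view [ inj₁ a≺b ] = via₁ a≺b
    ⊔-view [ inj₂ a≺b ] = via₂ a≺b
    ⊔-view (inj₁ a≺b ∷ b≺c) with ⊔-view b≺c
    ... | via₁ b≺c′ = via₁ (C₁.≺-trans a≺b b≺c′)
    ... | via₂ b≺c′ = ascent (<X-≤X-trans
            (≺-zero⇒<X C₁ H₁ a≺b (shared-zero (proj₂ (C₁.≺-dom a≺b)) (proj₁ (C₂.≺-dom b≺c′))))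
            (≺⇒≤X C₂ H₂ b≺c′))
    ... | ascent hb<hc = ascent (≤X-<X-trans (≺⇒≤X C₁ H₁ a≺b) hb<hc)
    ⊔-view (inj₂ a≺b ∷ b≺c) with ⊔-view b≺c
    ... | via₂ b≺c′ = via₂ (C₂.≺-trans a≺b b≺c′)
    ... | via₁ b≺c′ = ascent (<X-≤X-trans
            (≺-zero⇒<X C₂ H₂ a≺b (shared-zero (proj₁ (C₁.≺-dom b≺c′)) (proj₂ (C₂.≺-dom a≺b))))
            (≺⇒≤X C₁ H₁ b≺c′))
    ... | ascent hb<hc = ascent (≤X-<X-trans (≺⇒≤X C₂ H₂ a≺b) hb<hc)

    ⊔-isPartitionMap : IsPartitionMap U h
    ⊔-isPartitionMap = record
      { fixes-zero     = [ fixes-zero H₁ , fixes-zero H₂ ]′ ∘ ∈-⊔⁻ S₁ S₂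
      ; monotone       = λ _ _ → monotone-view ∘ ⊔-view
      ; descent-strict = λ _ _ → descent-strict-view ∘ ⊔-view
      ; top-colored    = [ top-colored H₁ , top-colored H₂ ]′ ∘ ∈-⊔⁻ S₁ S₂
      }
      where
        monotone-view : ∀ {a b} → ⊔-View a b → h a ≤X h b
        monotone-view (via₁ a≺b)   = ≺⇒≤X C₁ H₁ a≺b
        monotone-view (via₂ a≺b)   = ≺⇒≤X C₂ H₂ a≺b
        monotone-view (ascent h<h) = inj₁ h<h
        descent-strict-view : ∀ {a b} → ⊔-View a b → DescentStrict a b (h a) (h b)
        descent-strict-view (via₁ a≺b)   = ≺⇒descentStrict C₁ H₁ a≺b
        descent-strict-view (via₂ a≺b)   = ≺⇒descentStrict C₂ H₂ a≺b
        descent-strict-view (ascent h<h) = λ _ _ → h<h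

  glue : Map → Map → Map
  glue f₁ f₂ a with a ∈? elems S₁
  ... | yes _ = f₁ a
  ... | no  _ = f₂ a

  glue-on₁ : ∀ {f₁ f₂ a} → a ∈ elems S₁ → glue f₁ f₂ a ≡ f₁ a
  glue-on₁ {a = a} a∈₁ with a ∈? elems S₁
  ... | yes _   = refl
  ... | no  a∉₁ = contradiction a∈₁ a∉₁

  glue-on₂ : ∀ {f₁ f₂} → (∀ {a} → a ∈ elems S₁ → a ∈ elems S₂ → f₁ a ≡ f₂ a) →
             ∀ {a} → a ∈ elems S₂ → glue f₁ f₂ a ≡ f₂ a
  glue-on₂ agree {a} a∈₂ with a ∈? elems S₁
  ... | yes a∈₁ = agree a∈₁ a∈₂
  ... | no  _   = refl

  private
    Vec₁ = Vec (X r j) (length (elems S₁))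
    Vec₂ = Vec (X r j) (length (elems S₂))
    Vecᵁ = Vec (X r j) (length (elems U))

    positive : ∀ {S} → IsColoredPoset r n S → All (λ a → 1 ≤ ∣ a ∣) (Q S)
    positive C = All.map proj₁ (IsColoredPoset.Q-range C)

  unique₁ : Unique (elems S₁)
  unique₁ = elems-unique S₁ C₁.Q-distinct (positive C₁)

  unique₂ : Unique (elems S₂)
  unique₂ = elems-unique S₂ C₂.Q-distinct (positive C₂)

  uniqueᵁ : Unique (elems U)
  uniqueᵁ = elems-unique U
    (AllPairsP.++⁺ C₁.Q-distinct C₂.Q-distinct
      (All.tabulate λ a∈₁ → All.tabulate λ b∈₂ →
        disjoint _ _ (∈-++⁺ʳ (zeroElts r) a∈₁) (∈-++⁺ʳ (zeroElts r) b∈₂)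
                 (>⇒≢ (All.lookup (positive C₁) a∈₁))))
    (AllP.++⁺ (positive C₁) (positive C₂))

  glueVec : Vec₁ × Vec₂ → Vecᵁ
  glueVec (v₁ , v₂) = asVec U (glue (asMap S₁ v₁) (asMap S₂ v₂))

  splitVec : Vecᵁ → Vec₁ × Vec₂
  splitVec x = asVec S₁ (asMap U x) , asVec S₂ (asMap U x)

  glueVec-isColoredPartition : ∀ {v₁ v₂} →
    IsColoredPartition S₁ j v₁ × IsColoredPartition S₂ j v₂ →
    IsColoredPartition U j (glueVec (v₁ , v₂))
  glueVec-isColoredPartition (part₁ , part₂) = asVec-isColoredPartition (⊔-isPartitionMap
    (IsPartitionMap-cong (sym ∘ glue-on₁) F₁)
    (IsPartitionMap-cong (sym ∘ glue-on₂ (partitions-agree F₁ F₂)) F₂))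
    where
      F₁ = asMap-isPartitionMap part₁
      F₂ = asMap-isPartitionMap part₂

  splitVec-isColoredPartition : ∀ {x} → IsColoredPartition U j x →
    IsColoredPartition S₁ j (proj₁ (splitVec x)) × IsColoredPartition S₂ j (proj₂ (splitVec x))
  splitVec-isColoredPartition part =
    asVec-isColoredPartition (IsPartitionMap-restrict (∈-⊔⁺ˡ S₁ S₂) (λ a≺b → [ inj₁ a≺b ]) F) ,
    asVec-isColoredPartition (IsPartitionMap-restrict (∈-⊔⁺ʳ S₁ S₂) (λ a≺b → [ inj₂ a≺b ]) F)
    where F = asMap-isPartitionMap part

  splitVec∘glueVec : ∀ {v₁ v₂} →
    IsColoredPartition S₁ j v₁ × IsColoredPartition S₂ j v₂ →
    splitVec (glueVec (v₁ , v₂)) ≡ (v₁ , v₂)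
  splitVec∘glueVec {v₁} {v₂} (part₁ , part₂) = cong₂ _,_
    (trans (toVec-cong (elems S₁) (λ a∈₁ → trans (asMap-asVec U h (∈-⊔⁺ˡ S₁ S₂ a∈₁))
                                                 (glue-on₁ a∈₁)))
           (asVec-asMap S₁ unique₁))
    (trans (toVec-cong (elems S₂) (λ a∈₂ → trans (asMap-asVec U h (∈-⊔⁺ʳ S₁ S₂ a∈₂))
                                                 (glue-on₂ agree a∈₂)))
           (asVec-asMap S₂ unique₂))
    where
      h = glue (asMap S₁ v₁) (asMap S₂ v₂)
      agree = partitions-agree (asMap-isPartitionMap part₁) (asMap-isPartitionMap part₂)

  glueVec∘splitVec : ∀ {x} → IsColoredPartition U j x → glueVec (splitVec x) ≡ x
  glueVec∘splitVec {x} _ = trans (toVec-cong (elems U) glue≗m) (asVec-asMap U uniqueᵁ)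
    where
      m = asMap U x
      m₁ = asMap S₁ (asVec S₁ m)
      m₂ = asMap S₂ (asVec S₂ m)
      restrict₁≗m : ∀ {a} → a ∈ elems S₁ → m₁ a ≡ m a
      restrict₁≗m = asMap-asVec S₁ m
      restrict₂≗m : ∀ {a} → a ∈ elems S₂ → m₂ a ≡ m a
      restrict₂≗m = asMap-asVec S₂ m
      agree : ∀ {a} → a ∈ elems S₁ → a ∈ elems S₂ → m₁ a ≡ m₂ a
      agree a∈₁ a∈₂ = trans (restrict₁≗m a∈₁) (sym (restrict₂≗m a∈₂))
      glue≗m : ∀ {a} → a ∈ elems U → glue m₁ m₂ a ≡ m a
      glue≗m a∈ with ∈-⊔⁻ S₁ S₂ a∈
      ... | inj₁ a∈₁ = trans (glue-on₁ a∈₁) (restrict₁≗m a∈₁)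
      ... | inj₂ a∈₂ = trans (glue-on₂ agree a∈₂) (restrict₂≗m a∈₂)

mainTheorem4 : (r n : ℕ) ⦃ _ : NonZero r ⦄ (P₁ P₂ : ColoredPoset r n) →
    AbsDisjoint P₁ P₂ → (j N₁ N₂ : ℕ) →
    Ω (struct P₁) j N₁ → Ω (struct P₂) j N₂ →
    Ω (struct P₁ ⊔ struct P₂) j (N₁ * N₂)
mainTheorem4 _ _ P₁ P₂ disjoint j _ _ Ω₁ Ω₂ =
  HasSize-transport glueVec splitVec
    glueVec-isColoredPartition splitVec-isColoredPartition
    splitVec∘glueVec glueVec∘splitVec
    (HasSize-× Ω₁ Ω₂)
  where open Gluing P₁ P₂ disjoint j
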